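{- For every flag complex $\Delta$ there is a vertex-decomposable flag complex $\Gamma$ whose $h$-vector, after deleting trailing zero entries, equals the face vector of $\Delta$.
   Context: A flag complex is a simplicial complex equal to the independence complex $\mathrm{Ind}(G)$ (faces = independent sets) of some finite simple graph $G$ with at least one vertex. For a $(d-1)$-dimensional complex, the face vector is $(f_{ -1},\ldots,f_{d-1})$ with $f_i$ the number of $i$-dimensional faces ($f_{ -1}=1$) and the $h$-vector is $(h_0,\dots,h_d)$ with $h_j=\sum_{i=0}^j(-1)^{j-i}\binom{d-i}{j-i}f_{i-1}$. For a face $\sigma$, $\mathrm{link}_\Delta\sigma=\{\tau\in\Delta:\tau\cap\sigma=\emptyset,\tau\cup\sigma\in\Delta\}$, $\mathrm{del}_\Delta\sigma=\{\tau\in\Delta:\sigma\not\subseteq\tau\}$. A pure complex is vertex-decomposable if it is a simplex (unique maximal face) or has a vertex $v$ with $\mathrm{link}_\Delta\{v\}$ and $\mathrm{del}_\Delta\{v\}$ both vertex-decomposable. -}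

module Defs where

open import Data.Bool using (Bool; true; false; _∧_; _∨_; not; if_then_else_)
open import Data.Nat using (ℕ; zero; suc; _∸_; _⊔_; _≡ᵇ_)
open import Data.Nat.Combinatorics using (_C_)
open import Data.Integer using (ℤ; +_; -_; _*_; _+_)
open import Data.Fin using (Fin)
open import Data.Fin.Subset using (Subset; _∪_; _∩_; ⁅_⁆; ∣_∣)
open import Data.Vec using (Vec; []; _∷_; foldr)
open import Data.List using (List; []; _∷_; map; _++_; filterᵇ; length; upTo; reverse; dropWhileᵇ)
import Data.List as L
open import Data.Product using (Σ; _×_; ∃)
open import Relation.Binary.PropositionalEquality using (_≡_)

record Graph (n : ℕ) : Set where
  field
    adj    : Fin n → Fin n → Bool
    sym    : ∀ i j → adj i j ≡ adj j i
    irrefl : ∀ i → adj i i ≡ false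
open Graph public

Complex : ℕ → Set
Complex n = Subset n → Bool

allFinᵇ : ∀ {n} → (Fin n → Bool) → Bool
allFinᵇ {zero}  p = true
allFinᵇ {suc n} p = p Fin.zero ∧ allFinᵇ (λ i → p (Fin.suc i))

memᵇ : ∀ {n} → Fin n → Subset n → Bool
memᵇ i S = Data.Vec.lookup S i

isEmptyᵇ : ∀ {n} → Subset n → Bool
isEmptyᵇ S = allFinᵇ (λ i → not (memᵇ i S))

subsetᵇ : ∀ {n} → Subset n → Subset n → Bool
subsetᵇ σ τ = allFinᵇ (λ i → not (memᵇ i σ) ∨ memᵇ i τ)

Ind : ∀ {n} → Graph n → Complex n
Ind G S = allFinᵇ (λ i → allFinᵇ (λ j →
            not (memᵇ i S ∧ memᵇ j S ∧ adj G i j)))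

link : ∀ {n} → Complex n → Subset n → Complex n
link Δ σ τ = isEmptyᵇ (τ ∩ σ) ∧ Δ (τ ∪ σ)

del : ∀ {n} → Complex n → Subset n → Complex n
del Δ σ τ = not (subsetᵇ σ τ) ∧ Δ τ

IsFacet : ∀ {n} → Complex n → Subset n → Set
IsFacet {n} Δ F = (Δ F ≡ true) ×
  (∀ (G : Subset n) → Δ G ≡ true → subsetᵇ F G ≡ true → G ≡ F)

Pure : ∀ {n} → Complex n → Set
Pure Δ = ∀ F G → IsFacet Δ F → IsFacet Δ G → ∣ F ∣ ≡ ∣ G ∣

IsSimplex : ∀ {n} → Complex n → Set
IsSimplex Δ = Σ _ λ F → IsFacet Δ F × (∀ G → IsFacet Δ G → G ≡ F)

data VertexDecomposable {n : ℕ} : Complex n → Set where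
  simplex : ∀ {Δ} → Pure Δ → IsSimplex Δ → VertexDecomposable Δ
  decomp  : ∀ {Δ} → Pure Δ → (v : Fin n) → Δ ⁅ v ⁆ ≡ true →
            VertexDecomposable (link Δ ⁅ v ⁆) →
            VertexDecomposable (del Δ ⁅ v ⁆) →
            VertexDecomposable Δ

allSubsets : (n : ℕ) → List (Subset n)
allSubsets zero    = [] ∷ []
allSubsets (suc n) = map (true ∷_) (allSubsets n) ++ map (false ∷_) (allSubsets n)

faces : ∀ {n} → Complex n → List (Subset n)
faces {n} Δ = filterᵇ Δ (allSubsets n)

-- number of faces with k vertices, i.e. f_{k-1}
numFaces : ∀ {n} → Complex n → ℕ → ℕ
numFaces Δ k = length (filterᵇ (λ S → ∣ S ∣ ≡ᵇ k) (faces Δ))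

dimPlusOne : ∀ {n} → Complex n → ℕ
dimPlusOne Δ = L.foldr (λ S m → ∣ S ∣ ⊔ m) 0 (faces Δ)

-- (f_{-1}, f_0, …, f_{d-1})
fVector : ∀ {n} → Complex n → List ℕ
fVector Δ = map (numFaces Δ) (upTo (suc (dimPlusOne Δ)))

sumℤ : List ℤ → ℤ
sumℤ = L.foldr _+_ (+ 0)

hEntry : ∀ {n} → Complex n → ℕ → ℤ
hEntry Δ j = sumℤ (map (λ i → ((- (+ 1)) Data.Integer.^ (j ∸ i)) *
                              (+ (((d ∸ i) C (j ∸ i)) Data.Nat.* numFaces Δ i)))
                       (upTo (suc j)))
  where d = dimPlusOne Δ

hVector : ∀ {n} → Complex n → List ℤ
hVector Δ = map (hEntry Δ) (upTo (suc (dimPlusOne Δ)))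

isZeroℤ : ℤ → Bool
isZeroℤ (+ zero) = true
isZeroℤ _        = false

dropTrailingZeros : List ℤ → List ℤ
dropTrailingZeros xs = reverse (dropWhileᵇ isZeroℤ (reverse xs))

module Submission where

-- We take H = W(G), the whisker graph of G: a base
-- copy gᵢ of every vertex of G, carrying the edges of G, plus a leaf lᵢ
-- adjacent to gᵢ only.
--
-- Ind(W(G)) is the member RelInd ⊤ ∅ of a family
-- RelInd A I (A, I disjoint vertex sets of G): a face uses base vertices gᵢ
-- with i ∈ A, independent in G, and leaves lᵢ with i ∈ A ∪ I, never gᵢ and
-- lᵢ together.  Each RelInd A I is pure (facets have |A| + |I| vertices),
-- it is a simplex when A = ∅, and for v ∈ A its link and deletion at g_v
-- are again relative complexes with smaller A; induction on |A| concludes.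
--
-- h-vector.  h_j is a sum over all faces T of a weight depending only on
-- |T|.  A face of Ind(W(G)) is an independent base set S of G together
-- with a leaf set L disjoint from S; by Pascal's rule the inner sum over L
-- collapses to [|S| = j], so h_j(Ind W(G)) = f_{j-1}(Ind G).  Since
-- dim Ind W(G) + 1 = |V(G)|, the h-vector is the f-vector of Ind G padded
-- with zeros, which dropTrailingZeros removes.

open import Defs
open import Data.Bool using (Bool; true; false; _∧_; _∨_; not; if_then_else_)
open import Data.Bool.Properties using (∧-identityʳ; ∧-zeroʳ; T-≡)
open import Data.Nat using (ℕ; zero; suc; _+_; _*_; _∸_; _≤_; _<_; z≤n; s≤s; _<ᵇ_; _≡ᵇ_; _⊔_)
import Data.Nat.Properties as ℕP
open import Data.Nat.Combinatorics using (_C_; nCk+nC[k+1]≡[n+1]C[k+1])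
open import Data.Integer using (ℤ; +_; -_; _^_) renaming (_+_ to _+ℤ_; _*_ to _*ℤ_)
import Data.Integer.Properties as ℤP
open import Data.Integer.Tactic.RingSolver using (solve-∀)
open import Data.Fin using (Fin; _↑ˡ_; _↑ʳ_; splitAt)
open import Data.Fin.Properties using (splitAt-↑ˡ; splitAt-↑ʳ; splitAt⁻¹-↑ˡ; splitAt⁻¹-↑ʳ; ↑ˡ-injective; ↑ʳ-injective; _≟_)
open import Data.Fin.Subset using (Subset; ⁅_⁆; ⊤; ⊥; _∪_; _∩_; ∁; ∣_∣)
open import Data.Fin.Subset.Properties using (x∈⁅x⁆; x∈⁅y⁆⇒x≡y; p⊂q⇒∣p∣<∣q∣; ∣p∣≤n; ∣⊥∣≡0; ∣⊤∣≡n; ∣∁p∣≡n∸∣p∣)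
open import Data.Vec using ([]; _∷_; lookup; tabulate; _++_)
import Data.Vec as Vec
open import Data.Vec.Properties using (lookup-zipWith; lookup-replicate; lookup∘tabulate; tabulate∘lookup; tabulate-cong; lookup-++ˡ; lookup-++ʳ; []=⇒lookup; lookup⇒[]=)
open import Data.List using (List; []; _∷_; map; filterᵇ; length; upTo; downFrom; reverse; dropWhileᵇ) renaming (_++_ to _++ₗ_)
import Data.List as List
open import Data.List.Properties using (upTo-∷ʳ; reverse-map; reverse-upTo; reverse-downFrom; map-cong; map-∘)
open import Data.List.Membership.Propositional using (_∈_)
open import Data.List.Membership.Propositional.Properties using (∈-++⁺ˡ; ∈-++⁺ʳ; ∈-map⁺; ∈-filter⁺; ∈-filter⁻)
open import Data.List.Relation.Unary.Any using (here; there)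
open import Data.Sum using (_⊎_; inj₁; inj₂; [_,_]; map₂)
open import Data.Empty using (⊥-elim) renaming (⊥ to Empty)
open import Data.Product using (Σ; _×_; _,_; proj₁; proj₂)
open import Function using (_∘_)
open import Function.Bundles using (Equivalence)
open import Relation.Nullary using (yes; no)
open import Relation.Nullary.Decidable using (T?)
open import Relation.Binary using (tri<; tri≈; tri>)
open import Relation.Binary.PropositionalEquality using (_≡_; _≢_; refl; trans; cong; cong₂; subst; subst₂) renaming (sym to ≡-sym)
open Relation.Binary.PropositionalEquality.≡-Reasoning

bool-ext : ∀ {a b : Bool} → (a ≡ true → b ≡ true) → (b ≡ true → a ≡ true) → a ≡ b
bool-ext {true}  {true}  _ _ = refl
bool-ext {true}  {false} f _ = ≡-sym (f refl)
bool-ext {false} {true}  _ g = g refl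
bool-ext {false} {false} _ _ = refl

≡false⇒≢true : ∀ {a} → a ≡ false → a ≢ true
≡false⇒≢true refl ()

≢true⇒≡false : ∀ {b} → (b ≡ true → Empty) → b ≡ false
≢true⇒≡false {false} _ = refl
≢true⇒≡false {true}  f = ⊥-elim (f refl)

not≡true⇒≡false : ∀ {a} → not a ≡ true → a ≡ false
not≡true⇒≡false {false} _ = refl

≡false⇒not≡true : ∀ {a} → a ≡ false → not a ≡ true
≡false⇒not≡true refl = refl

∧-true⁻ : ∀ {a b} → a ∧ b ≡ true → (a ≡ true) × (b ≡ true)
∧-true⁻ {true} {true} _ = refl , refl

∧-true⁺ : ∀ {a b} → a ≡ true → b ≡ true → a ∧ b ≡ true
∧-true⁺ refl refl = refl

∨-true⁻ : ∀ {a b} → a ∨ b ≡ true → (a ≡ true) ⊎ (b ≡ true)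
∨-true⁻ {true}  _ = inj₁ refl
∨-true⁻ {false} e = inj₂ e

∨-true⁺ˡ : ∀ {a} b → a ≡ true → a ∨ b ≡ true
∨-true⁺ˡ _ refl = refl

∨-true⁺ʳ : ∀ a {b} → b ≡ true → a ∨ b ≡ true
∨-true⁺ʳ true  _ = refl
∨-true⁺ʳ false e = e

implies⁻ : ∀ {a b} → not a ∨ b ≡ true → a ≡ true → b ≡ true
implies⁻ {b = true} _ refl = refl

implies⁺ : ∀ a b → (a ≡ true → b ≡ true) → not a ∨ b ≡ true
implies⁺ true  _ f = f refl
implies⁺ false _ _ = refl

nand⁻ : ∀ {a b} → not (a ∧ b) ≡ true → a ≡ true → b ≡ true → Empty
nand⁻ () refl refl

nand⁺ : ∀ a b → (a ≡ true → b ≡ true → Empty) → not (a ∧ b) ≡ true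
nand⁺ true  true  f = ⊥-elim (f refl refl)
nand⁺ true  false _ = refl
nand⁺ false _     _ = refl

nand₃⁻ : ∀ {a b c} → not (a ∧ b ∧ c) ≡ true → a ≡ true → b ≡ true → c ≡ false
nand₃⁻ {c = false} _ refl refl = refl

nand₃⁺ : ∀ a b c → (a ≡ true → b ≡ true → c ≡ false) → not (a ∧ b ∧ c) ≡ true
nand₃⁺ true  true  c f = ≡false⇒not≡true (f refl refl)
nand₃⁺ true  false _ _ = refl
nand₃⁺ false _     _ _ = refl

allFinᵇ⁻ : ∀ {n} (p : Fin n → Bool) → allFinᵇ p ≡ true → ∀ i → p i ≡ true
allFinᵇ⁻ p e Fin.zero    = proj₁ (∧-true⁻ e)
allFinᵇ⁻ p e (Fin.suc i) = allFinᵇ⁻ (p ∘ Fin.suc) (proj₂ (∧-true⁻ {p Fin.zero} e)) i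

allFinᵇ⁺ : ∀ {n} (p : Fin n → Bool) → (∀ i → p i ≡ true) → allFinᵇ p ≡ true
allFinᵇ⁺ {zero}  p _ = refl
allFinᵇ⁺ {suc n} p f = ∧-true⁺ (f Fin.zero) (allFinᵇ⁺ (p ∘ Fin.suc) (f ∘ Fin.suc))

Ind⁻ : ∀ {n} (G : Graph n) S → Ind G S ≡ true →
       ∀ i j → lookup S i ≡ true → lookup S j ≡ true → adj G i j ≡ false
Ind⁻ G S e i j = nand₃⁻ (allFinᵇ⁻ _ (allFinᵇ⁻ _ e i) j)

Ind⁺ : ∀ {n} (G : Graph n) S →
       (∀ i j → lookup S i ≡ true → lookup S j ≡ true → adj G i j ≡ false) → Ind G S ≡ true
Ind⁺ G S h = allFinᵇ⁺ _ (λ i → allFinᵇ⁺ _ (λ j → nand₃⁺ _ _ _ (h i j)))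

subset-ext : ∀ {n} {u w : Subset n} → (∀ x → lookup u x ≡ lookup w x) → u ≡ w
subset-ext {u = u} {w} h =
  trans (≡-sym (tabulate∘lookup u)) (trans (tabulate-cong h) (tabulate∘lookup w))

lookup-⊥ : ∀ {n} (i : Fin n) → lookup (⊥ {n}) i ≡ false
lookup-⊥ i = lookup-replicate i false

lookup-⊤ : ∀ {n} (i : Fin n) → lookup (⊤ {n}) i ≡ true
lookup-⊤ i = lookup-replicate i true

lookup-∪ : ∀ {n} (p q : Subset n) i → lookup (p ∪ q) i ≡ lookup p i ∨ lookup q i
lookup-∪ p q i = lookup-zipWith _∨_ i p q

lookup-∩ : ∀ {n} (p q : Subset n) i → lookup (p ∩ q) i ≡ lookup p i ∧ lookup q i
lookup-∩ p q i = lookup-zipWith _∧_ i p q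

lookup-⁅⁆-self : ∀ {n} (x : Fin n) → lookup ⁅ x ⁆ x ≡ true
lookup-⁅⁆-self x = []=⇒lookup (x∈⁅x⁆ x)

lookup-⁅⁆⁻ : ∀ {n} {x y : Fin n} → lookup ⁅ x ⁆ y ≡ true → y ≡ x
lookup-⁅⁆⁻ {x = x} {y} e = x∈⁅y⁆⇒x≡y x (lookup⇒[]= y ⁅ x ⁆ e)

lookup-⁅⁆-other : ∀ {n} {x y : Fin n} → y ≢ x → lookup ⁅ x ⁆ y ≡ false
lookup-⁅⁆-other {x = x} {y} y≢x with lookup ⁅ x ⁆ y in e
... | false = refl
... | true  = ⊥-elim (y≢x (lookup-⁅⁆⁻ e))

∪⁅⁆⁻ : ∀ {n} (F : Subset n) x y → lookup (F ∪ ⁅ x ⁆) y ≡ true → (lookup F y ≡ true) ⊎ (y ≡ x)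
∪⁅⁆⁻ F x y e with ∨-true⁻ (trans (≡-sym (lookup-∪ F ⁅ x ⁆ y)) e)
... | inj₁ p = inj₁ p
... | inj₂ p = inj₂ (lookup-⁅⁆⁻ p)

∪⁅⁆-old : ∀ {n} (F : Subset n) x y → lookup F y ≡ true → lookup (F ∪ ⁅ x ⁆) y ≡ true
∪⁅⁆-old F x y e = trans (lookup-∪ F ⁅ x ⁆ y) (∨-true⁺ˡ _ e)

∪⁅⁆-new : ∀ {n} (F : Subset n) x → lookup (F ∪ ⁅ x ⁆) x ≡ true
∪⁅⁆-new F x = trans (lookup-∪ F ⁅ x ⁆ x) (∨-true⁺ʳ (lookup F x) (lookup-⁅⁆-self x))

∪⁅⁆-other : ∀ {n} (F : Subset n) x y → y ≢ x → lookup (F ∪ ⁅ x ⁆) y ≡ lookup F y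
∪⁅⁆-other F x y y≢x = bool-ext
  (λ e → [ (λ p → p) , (λ p → ⊥-elim (y≢x p)) ] (∪⁅⁆⁻ F x y e))
  (∪⁅⁆-old F x y)

link-condition : ∀ {n} (τ : Subset n) x → isEmptyᵇ (τ ∩ ⁅ x ⁆) ≡ not (lookup τ x)
link-condition τ x = bool-ext
  (λ e → subst (λ b → not b ≡ true)
           (trans (lookup-∩ τ ⁅ x ⁆ x) (trans (cong (lookup τ x ∧_) (lookup-⁅⁆-self x)) (∧-identityʳ _)))
           (allFinᵇ⁻ _ e x))
  (λ e → allFinᵇ⁺ _ (λ y → ≡false⇒not≡true (outside y (not≡true⇒≡false e))))
  where
    outside : ∀ y → lookup τ x ≡ false → lookup (τ ∩ ⁅ x ⁆) y ≡ false
    outside y τx with y ≟ x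
    ... | yes refl = trans (lookup-∩ τ ⁅ x ⁆ x) (cong (_∧ _) τx)
    ... | no y≢x   = trans (lookup-∩ τ ⁅ x ⁆ y)
                       (trans (cong (lookup τ y ∧_) (lookup-⁅⁆-other y≢x)) (∧-zeroʳ _))

deletion-condition : ∀ {n} (τ : Subset n) x → subsetᵇ ⁅ x ⁆ τ ≡ lookup τ x
deletion-condition τ x = bool-ext
  (λ e → implies⁻ (allFinᵇ⁻ _ e x) (lookup-⁅⁆-self x))
  (λ e → allFinᵇ⁺ (λ y → not (lookup ⁅ x ⁆ y) ∨ lookup τ y)
           (λ y → implies⁺ _ _ (λ p → subst (λ z → lookup τ z ≡ true) (≡-sym (lookup-⁅⁆⁻ p)) e)))

cnt : Bool → ℕ
cnt true  = 1
cnt false = 0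

∣∷∣ : ∀ {n} b (S : Subset n) → ∣ b ∷ S ∣ ≡ cnt b + ∣ S ∣
∣∷∣ true  S = refl
∣∷∣ false S = refl

∣++∣ : ∀ {m n} (S : Subset m) (L : Subset n) → ∣ S ++ L ∣ ≡ ∣ S ∣ + ∣ L ∣
∣++∣ []      L = refl
∣++∣ (s ∷ S) L = begin
  ∣ s ∷ (S ++ L) ∣        ≡⟨ ∣∷∣ s (S ++ L) ⟩
  cnt s + ∣ S ++ L ∣      ≡⟨ cong (λ t → cnt s + t) (∣++∣ S L) ⟩
  cnt s + (∣ S ∣ + ∣ L ∣) ≡⟨ ≡-sym (ℕP.+-assoc (cnt s) _ _) ⟩
  (cnt s + ∣ S ∣) + ∣ L ∣ ≡⟨ cong (_+ ∣ L ∣) (≡-sym (∣∷∣ s S)) ⟩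
  ∣ s ∷ S ∣ + ∣ L ∣       ∎

cnt-disjoint : ∀ {a b} → (a ≡ true → b ≡ false) → cnt a + cnt b ≡ cnt (a ∨ b)
cnt-disjoint {true}  {true}  f with f refl
... | ()
cnt-disjoint {true}  {false} _ = refl
cnt-disjoint {false} {b}     _ = refl

size-pairs : ∀ {n} (S L A I : Subset n) →
  (∀ k → cnt (lookup S k) + cnt (lookup L k) ≡ cnt (lookup A k) + cnt (lookup I k)) →
  ∣ S ∣ + ∣ L ∣ ≡ ∣ A ∣ + ∣ I ∣
size-pairs [] [] [] [] _ = refl
size-pairs (s ∷ S) (l ∷ L) (a ∷ A) (i ∷ I) h
  rewrite ∣∷∣ s S | ∣∷∣ l L | ∣∷∣ a A | ∣∷∣ i I =
  trans (interchange (cnt s) (∣ S ∣) (cnt l) (∣ L ∣))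
    (trans (cong₂ _+_ (h Fin.zero) (size-pairs S L A I (h ∘ Fin.suc)))
      (interchange (cnt a) (cnt i) (∣ A ∣) (∣ I ∣)))
  where
    interchange : ∀ w x y z → (w + x) + (y + z) ≡ (w + y) + (x + z)
    interchange w x y z = begin
      (w + x) + (y + z) ≡⟨ ℕP.+-assoc w x (y + z) ⟩
      w + (x + (y + z)) ≡⟨ cong (λ t → w + t) (ℕP.+-comm x (y + z)) ⟩
      w + ((y + z) + x) ≡⟨ cong (λ t → w + t) (ℕP.+-assoc y z x) ⟩
      w + (y + (z + x)) ≡⟨ cong (λ t → w + (y + t)) (ℕP.+-comm z x) ⟩
      w + (y + (x + z)) ≡⟨ ≡-sym (ℕP.+-assoc w y (x + z)) ⟩
      (w + y) + (x + z) ∎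

size-strict : ∀ {n} (B A : Subset n) v → (∀ i → lookup B i ≡ true → lookup A i ≡ true) →
              lookup B v ≡ false → lookup A v ≡ true → ∣ B ∣ < ∣ A ∣
size-strict B A v B⊆A Bv Av = p⊂q⇒∣p∣<∣q∣ {p = B} {q = A}
  ( (λ {i} i∈B → lookup⇒[]= i A (B⊆A i ([]=⇒lookup i∈B)))
  , v , lookup⇒[]= v A Av , (λ v∈B → ≡false⇒≢true Bv ([]=⇒lookup v∈B)))

emptyOrMember : ∀ {n} (A : Subset n) → (∀ i → lookup A i ≡ false) ⊎ Σ (Fin n) (λ v → lookup A v ≡ true)
emptyOrMember []          = inj₁ (λ ())
emptyOrMember (true ∷ A)  = inj₂ (Fin.zero , refl)
emptyOrMember (false ∷ A) with emptyOrMember A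
... | inj₁ h       = inj₁ (λ { Fin.zero → refl ; (Fin.suc i) → h i })
... | inj₂ (v , e) = inj₂ (Fin.suc v , e)

_≐_ : ∀ {n} → Complex n → Complex n → Set
Δ ≐ Δ' = ∀ S → Δ S ≡ Δ' S

≐-sym : ∀ {n} {Δ Δ' : Complex n} → Δ ≐ Δ' → Δ' ≐ Δ
≐-sym e S = ≡-sym (e S)

facet-≐ : ∀ {n} {Δ Δ' : Complex n} → Δ ≐ Δ' → ∀ F → IsFacet Δ F → IsFacet Δ' F
facet-≐ e F (face , maximal) = trans (≡-sym (e F)) face , λ G g → maximal G (trans (e G) g)

pure-≐ : ∀ {n} {Δ Δ' : Complex n} → Δ ≐ Δ' → Pure Δ → Pure Δ'
pure-≐ e P F G f g = P F G (facet-≐ (≐-sym e) F f) (facet-≐ (≐-sym e) G g)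

simplex-≐ : ∀ {n} {Δ Δ' : Complex n} → Δ ≐ Δ' → IsSimplex Δ → IsSimplex Δ'
simplex-≐ e (F , f , unique) = F , facet-≐ e F f , λ G g → unique G (facet-≐ (≐-sym e) G g)

link-≐ : ∀ {n} {Δ Δ' : Complex n} σ → Δ ≐ Δ' → link Δ σ ≐ link Δ' σ
link-≐ σ e τ = cong (_ ∧_) (e _)

del-≐ : ∀ {n} {Δ Δ' : Complex n} σ → Δ ≐ Δ' → del Δ σ ≐ del Δ' σ
del-≐ σ e τ = cong (_ ∧_) (e _)

VD-≐ : ∀ {n} {Δ Δ' : Complex n} → Δ ≐ Δ' → VertexDecomposable Δ → VertexDecomposable Δ'
VD-≐ e (simplex p s)      = simplex (pure-≐ e p) (simplex-≐ e s)
VD-≐ e (decomp p v x l d) = decomp (pure-≐ e p) v (trans (≡-sym (e _)) x)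
  (VD-≐ (link-≐ ⁅ v ⁆ e) l) (VD-≐ (del-≐ ⁅ v ⁆ e) d)

data Side (m n : ℕ) : Fin (m + n) → Set where
  left  : (i : Fin m) → Side m n (i ↑ˡ n)
  right : (j : Fin n) → Side m n (m ↑ʳ j)

side : ∀ m {n} (x : Fin (m + n)) → Side m n x
side m {n} x with splitAt m x in e
... | inj₁ i = subst (Side m n) (splitAt⁻¹-↑ˡ e) (left i)
... | inj₂ j = subst (Side m n) (splitAt⁻¹-↑ʳ e) (right j)

↑ˡ≢↑ʳ : ∀ {m n} (i : Fin m) (j : Fin n) → i ↑ˡ n ≢ m ↑ʳ j
↑ˡ≢↑ʳ {m} {n} i j e with trans (≡-sym (splitAt-↑ˡ m i n)) (trans (cong (splitAt m) e) (splitAt-↑ʳ m n j))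
... | ()

-- Boolean bookkeeping for the availability of a leaf lᵢ: with a = [i ∈ A],
-- o = [i ∈ I], x = [i adjacent to v], s = [i = v], it is "a ∨ o" before,
-- and after passing to the link resp. deletion at g_v:

link-leaf⁺ : ∀ a o x s → a ∨ o ≡ true → s ≡ false → (a ∧ (not s ∧ not x)) ∨ (o ∨ (a ∧ x)) ≡ true
link-leaf⁺ true  o true  false _ _ = ∨-true⁺ʳ false (∨-true⁺ʳ o refl)
link-leaf⁺ true  o false false _ _ = refl
link-leaf⁺ false true x  false _ _ = refl

link-leaf⁻ : ∀ a o x s → (a ∧ (not s ∧ not x)) ∨ (o ∨ (a ∧ x)) ≡ true → a ∨ o ≡ true
link-leaf⁻ true  o     _ _ _ = refl
link-leaf⁻ false true  _ _ _ = refl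

del-leaf⁺ : ∀ a o s → a ∨ o ≡ true → (a ∧ not s) ∨ (o ∨ s) ≡ true
del-leaf⁺ true  o false _ = refl
del-leaf⁺ true  o true  _ = ∨-true⁺ʳ false (∨-true⁺ʳ o refl)
del-leaf⁺ false true s  _ = refl

del-leaf⁻ : ∀ a o s → (s ≡ true → a ≡ true) → (a ∧ not s) ∨ (o ∨ s) ≡ true → a ∨ o ≡ true
del-leaf⁻ true  o     s     _ _ = refl
del-leaf⁻ false true  s     _ _ = refl
del-leaf⁻ false false true  h _ = h refl

-- The whisker graph W(G) on Fin (N + N): base copies gᵢ = i ↑ˡ N carry the
-- edges of G, and each leaf lᵢ = N ↑ʳ i is adjacent to gᵢ only.

module Whisker {N : ℕ} (G : Graph N) where

  whiskerAdj : Fin N ⊎ Fin N → Fin N ⊎ Fin N → Bool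
  whiskerAdj (inj₁ i) (inj₁ j) = adj G i j
  whiskerAdj (inj₁ i) (inj₂ j) = lookup ⁅ i ⁆ j
  whiskerAdj (inj₂ i) (inj₁ j) = lookup ⁅ j ⁆ i
  whiskerAdj (inj₂ i) (inj₂ j) = false

  whiskerAdj-sym : ∀ s t → whiskerAdj s t ≡ whiskerAdj t s
  whiskerAdj-sym (inj₁ i) (inj₁ j) = Graph.sym G i j
  whiskerAdj-sym (inj₁ i) (inj₂ j) = refl
  whiskerAdj-sym (inj₂ i) (inj₁ j) = refl
  whiskerAdj-sym (inj₂ i) (inj₂ j) = refl

  whiskerAdj-irrefl : ∀ s → whiskerAdj s s ≡ false
  whiskerAdj-irrefl (inj₁ i) = irrefl G i
  whiskerAdj-irrefl (inj₂ i) = refl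

  W : Graph (N + N)
  W = record
    { adj    = λ x y → whiskerAdj (splitAt N x) (splitAt N y)
    ; sym    = λ x y → whiskerAdj-sym (splitAt N x) (splitAt N y)
    ; irrefl = λ x → whiskerAdj-irrefl (splitAt N x) }

  base leaf : Fin N → Fin (N + N)
  base i = i ↑ˡ N
  leaf i = N ↑ʳ i

  adjW-base-base : ∀ i j → adj W (base i) (base j) ≡ adj G i j
  adjW-base-base i j rewrite splitAt-↑ˡ N i N | splitAt-↑ˡ N j N = refl

  adjW-base-leaf : ∀ i j → adj W (base i) (leaf j) ≡ lookup ⁅ i ⁆ j
  adjW-base-leaf i j rewrite splitAt-↑ˡ N i N | splitAt-↑ʳ N N j = refl

  adjW-leaf-base : ∀ i j → adj W (leaf i) (base j) ≡ lookup ⁅ j ⁆ i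
  adjW-leaf-base i j rewrite splitAt-↑ʳ N N i | splitAt-↑ˡ N j N = refl

  adjW-leaf-leaf : ∀ i j → adj W (leaf i) (leaf j) ≡ false
  adjW-leaf-leaf i j rewrite splitAt-↑ʳ N N i | splitAt-↑ʳ N N j = refl

  base-injective : ∀ {i j} → base i ≡ base j → i ≡ j
  base-injective {i} {j} = ↑ˡ-injective N i j

  leaf-injective : ∀ {i j} → leaf i ≡ leaf j → i ≡ j
  leaf-injective {i} {j} = ↑ʳ-injective N i j

  baseOf leafOf : Subset (N + N) → Fin N → Bool
  baseOf T i = lookup T (base i)
  leafOf T i = lookup T (leaf i)

  record RelFace (A I : Subset N) (T : Subset (N + N)) : Set where
    field
      independent : ∀ i j → baseOf T i ≡ true → baseOf T j ≡ true → adj G i j ≡ false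
      base⊆A      : ∀ i → baseOf T i ≡ true → lookup A i ≡ true
      leaf⊆A∪I    : ∀ i → leafOf T i ≡ true → lookup A i ∨ lookup I i ≡ true
      notBoth     : ∀ i → baseOf T i ≡ true → leafOf T i ≡ true → Empty
  open RelFace

  RelInd : Subset N → Subset N → Complex (N + N)
  RelInd A I T =
        allFinᵇ (λ i → allFinᵇ (λ j → not (baseOf T i ∧ baseOf T j ∧ adj G i j)))
    ∧ (allFinᵇ (λ i → not (baseOf T i) ∨ lookup A i)
    ∧ (allFinᵇ (λ i → not (leafOf T i) ∨ (lookup A i ∨ lookup I i))
    ∧  allFinᵇ (λ i → not (baseOf T i ∧ leafOf T i))))

  RelInd⁻ : ∀ A I T → RelInd A I T ≡ true → RelFace A I T
  RelInd⁻ A I T e with ∧-true⁻ e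
  ... | e₁ , r₁ with ∧-true⁻ r₁
  ... | e₂ , r₂ with ∧-true⁻ r₂
  ... | e₃ , e₄ = record
    { independent = λ i j → nand₃⁻ (allFinᵇ⁻ _ (allFinᵇ⁻ _ e₁ i) j)
    ; base⊆A      = λ i → implies⁻ (allFinᵇ⁻ _ e₂ i)
    ; leaf⊆A∪I    = λ i → implies⁻ (allFinᵇ⁻ _ e₃ i)
    ; notBoth     = λ i → nand⁻ (allFinᵇ⁻ _ e₄ i) }

  RelInd⁺ : ∀ A I T → RelFace A I T → RelInd A I T ≡ true
  RelInd⁺ A I T f = ∧-true⁺
    (allFinᵇ⁺ _ (λ i → allFinᵇ⁺ _ (λ j → nand₃⁺ _ _ _ (independent f i j))))
    (∧-true⁺ (allFinᵇ⁺ _ (λ i → implies⁺ _ _ (base⊆A f i)))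
      (∧-true⁺ (allFinᵇ⁺ _ (λ i → implies⁺ _ _ (leaf⊆A∪I f i)))
        (allFinᵇ⁺ _ (λ i → nand⁺ _ _ (notBoth f i)))))

  IndW⇒RelFace : ∀ T → Ind W T ≡ true → RelFace ⊤ ⊥ T
  IndW⇒RelFace T e = record
    { independent = λ i j p q → trans (≡-sym (adjW-base-base i j)) (Ind⁻ W T e (base i) (base j) p q)
    ; base⊆A      = λ i _ → lookup-⊤ i
    ; leaf⊆A∪I    = λ i _ → ∨-true⁺ˡ _ (lookup-⊤ i)
    ; notBoth     = λ i p q → ≡false⇒≢true
        (trans (≡-sym (adjW-base-leaf i i)) (Ind⁻ W T e (base i) (leaf i) p q)) (lookup-⁅⁆-self i) }

  RelFace⇒IndW : ∀ A I T → RelFace A I T → Ind W T ≡ true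
  RelFace⇒IndW A I T f = Ind⁺ W T (λ x y → edgeless (side N x) (side N y))
    where
      edgeless : ∀ {x y} → Side N N x → Side N N y → lookup T x ≡ true → lookup T y ≡ true → adj W x y ≡ false
      edgeless (left i)  (left j)  p q = trans (adjW-base-base i j) (independent f i j p q)
      edgeless (left i)  (right j) p q with i ≟ j
      ... | yes refl = ⊥-elim (notBoth f i p q)
      ... | no i≢j   = trans (adjW-base-leaf i j) (lookup-⁅⁆-other (λ j≡i → i≢j (≡-sym j≡i)))
      edgeless (right i) (left j)  p q with i ≟ j
      ... | yes refl = ⊥-elim (notBoth f i q p)
      ... | no i≢j   = trans (adjW-leaf-base i j) (lookup-⁅⁆-other i≢j)
      edgeless (right i) (right j) p q = adjW-leaf-leaf i j

  IndW≐RelInd : Ind W ≐ RelInd ⊤ ⊥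
  IndW≐RelInd T = bool-ext (λ e → RelInd⁺ ⊤ ⊥ T (IndW⇒RelFace T e))
                           (λ e → RelFace⇒IndW ⊤ ⊥ T (RelInd⁻ ⊤ ⊥ T e))

  Disjoint : Subset N → Subset N → Set
  Disjoint A I = ∀ i → lookup A i ≡ true → lookup I i ≡ false

  -- Purity: a facet of RelInd A I contains, for every i ∈ A ∪ I, exactly
  -- one of gᵢ, lᵢ, so all facets have |A| + |I| vertices.

  -- A facet not using gᵢ uses lᵢ whenever lᵢ is allowed: otherwise it
  -- could be enlarged by lᵢ.
  facet-saturated : ∀ A I F → IsFacet (RelInd A I) F →
                    ∀ i → lookup A i ∨ lookup I i ≡ true → baseOf F i ≡ false → leafOf F i ≡ true
  facet-saturated A I F (F∈ , maximal) i allowed gᵢ∉F =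
    subst (λ T → leafOf T i ≡ true) (maximal F' (RelInd⁺ A I F' F'-face) F⊆F') (∪⁅⁆-new F (leaf i))
    where
      F' = F ∪ ⁅ leaf i ⁆
      f  = RelInd⁻ A I F F∈
      same-base : ∀ j → baseOf F' j ≡ baseOf F j
      same-base j = ∪⁅⁆-other F (leaf i) (base j) (↑ˡ≢↑ʳ j i)
      from-F : ∀ j → baseOf F' j ≡ true → baseOf F j ≡ true
      from-F j p = trans (≡-sym (same-base j)) p
      old-or-new : ∀ j → leafOf F' j ≡ true → (leafOf F j ≡ true) ⊎ (j ≡ i)
      old-or-new j p = map₂ leaf-injective (∪⁅⁆⁻ F (leaf i) (leaf j) p)
      F'-face : RelFace A I F'
      F'-face = record
        { independent = λ j k p q → independent f j k (from-F j p) (from-F k q)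
        ; base⊆A      = λ j p → base⊆A f j (from-F j p)
        ; leaf⊆A∪I    = λ j p → [ leaf⊆A∪I f j , (λ { refl → allowed }) ] (old-or-new j p)
        ; notBoth     = λ j p q → [ notBoth f j (from-F j p) , (λ { refl → ≡false⇒≢true gᵢ∉F (from-F j p) }) ]
                                   (old-or-new j q) }
      F⊆F' : subsetᵇ F F' ≡ true
      F⊆F' = allFinᵇ⁺ _ (λ y → implies⁺ _ _ (∪⁅⁆-old F (leaf i) y))

  facet-covers : ∀ A I F → IsFacet (RelInd A I) F →
                 ∀ k → baseOf F k ∨ leafOf F k ≡ lookup A k ∨ lookup I k
  facet-covers A I F fc k = bool-ext covered saturated
    where
      f = RelInd⁻ A I F (proj₁ fc)
      covered : baseOf F k ∨ leafOf F k ≡ true → lookup A k ∨ lookup I k ≡ true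
      covered e = [ (λ b → ∨-true⁺ˡ _ (base⊆A f k b)) , leaf⊆A∪I f k ] (∨-true⁻ e)
      saturated : lookup A k ∨ lookup I k ≡ true → baseOf F k ∨ leafOf F k ≡ true
      saturated e with baseOf F k in b
      ... | true  = refl
      ... | false = facet-saturated A I F fc k e b

  facet-size : ∀ A I → Disjoint A I → ∀ F → IsFacet (RelInd A I) F → ∣ F ∣ ≡ ∣ A ∣ + ∣ I ∣
  facet-size A I A∩I=∅ F fc with Vec.splitAt N F
  ... | S , L , refl = trans (∣++∣ S L) (size-pairs S L A I pointwise)
    where
      f = RelInd⁻ A I (S ++ L) (proj₁ fc)
      pointwise : ∀ k → cnt (lookup S k) + cnt (lookup L k) ≡ cnt (lookup A k) + cnt (lookup I k)
      pointwise k = begin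
        cnt (lookup S k) + cnt (lookup L k)
          ≡⟨ cong₂ (λ s l → cnt s + cnt l) (≡-sym (lookup-++ˡ S L k)) (≡-sym (lookup-++ʳ S L k)) ⟩
        cnt (baseOf (S ++ L) k) + cnt (leafOf (S ++ L) k)
          ≡⟨ cnt-disjoint (λ p → ≢true⇒≡false (notBoth f k p)) ⟩
        cnt (baseOf (S ++ L) k ∨ leafOf (S ++ L) k)
          ≡⟨ cong cnt (facet-covers A I (S ++ L) fc k) ⟩
        cnt (lookup A k ∨ lookup I k)
          ≡⟨ ≡-sym (cnt-disjoint (A∩I=∅ k)) ⟩
        cnt (lookup A k) + cnt (lookup I k) ∎

  RelInd-pure : ∀ A I → Disjoint A I → Pure (RelInd A I)
  RelInd-pure A I A∩I=∅ F F' f f' = trans (facet-size A I A∩I=∅ F f) (≡-sym (facet-size A I A∩I=∅ F' f'))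

  leavesOver : Subset N → Subset (N + N)
  leavesOver I = ⊥ ++ I

  baseOf-leavesOver : ∀ I i → baseOf (leavesOver I) i ≡ false
  baseOf-leavesOver I i = trans (lookup-++ˡ (⊥ {N}) I i) (lookup-⊥ i)

  leavesOver-face : ∀ A I → RelFace A I (leavesOver I)
  leavesOver-face A I = record
    { independent = λ i _ p → ⊥-elim (≡false⇒≢true (baseOf-leavesOver I i) p)
    ; base⊆A      = λ i p → ⊥-elim (≡false⇒≢true (baseOf-leavesOver I i) p)
    ; leaf⊆A∪I    = λ i p → ∨-true⁺ʳ (lookup A i) (trans (≡-sym (lookup-++ʳ (⊥ {N}) I i)) p)
    ; notBoth     = λ i p _ → ≡false⇒≢true (baseOf-leavesOver I i) p }

  leavesOver-unique : ∀ A I → (∀ i → lookup A i ≡ false) → ∀ T → RelFace A I T →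
                      (∀ i → lookup I i ≡ true → leafOf T i ≡ true) → T ≡ leavesOver I
  leavesOver-unique A I A=∅ T f I⊆T = subset-ext (λ x → pointwise (side N x))
    where
      pointwise : ∀ {x} → Side N N x → lookup T x ≡ lookup (leavesOver I) x
      pointwise (left i) = trans (≢true⇒≡false (λ p → ≡false⇒≢true (A=∅ i) (base⊆A f i p)))
                                 (≡-sym (baseOf-leavesOver I i))
      pointwise (right j) = trans (bool-ext
          (λ p → [ (λ a → ⊥-elim (≡false⇒≢true (A=∅ j) a)) , (λ o → o) ] (∨-true⁻ (leaf⊆A∪I f j p)))
          (I⊆T j))
        (≡-sym (lookup-++ʳ (⊥ {N}) I j))

  RelInd-simplex : ∀ A I → (∀ i → lookup A i ≡ false) → IsSimplex (RelInd A I)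
  RelInd-simplex A I A=∅ = leavesOver I , (RelInd⁺ A I _ (leavesOver-face A I) , maximal) , unique
    where
      maximal : ∀ T → RelInd A I T ≡ true → subsetᵇ (leavesOver I) T ≡ true → T ≡ leavesOver I
      maximal T T∈ sub = leavesOver-unique A I A=∅ T (RelInd⁻ A I T T∈)
        (λ i p → implies⁻ (allFinᵇ⁻ _ sub (leaf i)) (trans (lookup-++ʳ (⊥ {N}) I i) p))
      unique : ∀ T → IsFacet (RelInd A I) T → T ≡ leavesOver I
      unique T fc = leavesOver-unique A I A=∅ T f
        (λ i p → facet-saturated A I T fc i (∨-true⁺ʳ (lookup A i) p) no-base)
        where
          f = RelInd⁻ A I T (proj₁ fc)
          no-base : ∀ {i} → baseOf T i ≡ false
          no-base {i} = ≢true⇒≡false (λ p → ≡false⇒≢true (A=∅ i) (base⊆A f i p))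

  -- In the link, v and its neighbours leave A; the neighbours
  -- can still carry leaves, so they join I.

  linkA : Subset N → Fin N → Subset N
  linkA A v = tabulate (λ i → lookup A i ∧ (not (lookup ⁅ v ⁆ i) ∧ not (adj G v i)))

  linkI : Subset N → Subset N → Fin N → Subset N
  linkI A I v = tabulate (λ i → lookup I i ∨ (lookup A i ∧ adj G v i))

  delA : Subset N → Fin N → Subset N
  delA A v = tabulate (λ i → lookup A i ∧ not (lookup ⁅ v ⁆ i))

  delI : Subset N → Fin N → Subset N
  delI I v = tabulate (λ i → lookup I i ∨ lookup ⁅ v ⁆ i)

  linkA⊆A : ∀ A v i → lookup (linkA A v) i ≡ true → lookup A i ≡ true
  linkA⊆A A v i p = proj₁ (∧-true⁻ (trans (≡-sym (lookup∘tabulate _ i)) p))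

  linkA-nonadjacent : ∀ A v i → lookup (linkA A v) i ≡ true → adj G v i ≡ false
  linkA-nonadjacent A v i p =
    not≡true⇒≡false (proj₂ (∧-true⁻ {not (lookup ⁅ v ⁆ i)}
      (proj₂ (∧-true⁻ {lookup A i} (trans (≡-sym (lookup∘tabulate _ i)) p)))))

  linkA-v : ∀ A v → lookup (linkA A v) v ≡ false
  linkA-v A v = trans (lookup∘tabulate _ v)
    (trans (cong (λ b → lookup A v ∧ (not b ∧ not (adj G v v))) (lookup-⁅⁆-self v)) (∧-zeroʳ _))

  linkI-v : ∀ A I v → lookup A v ≡ true → Disjoint A I → lookup (linkI A I v) v ≡ false
  linkI-v A I v Av A∩I=∅ = trans (lookup∘tabulate _ v)
    (trans (cong₂ (λ o x → o ∨ (lookup A v ∧ x)) (A∩I=∅ v Av) (irrefl G v)) (∧-zeroʳ (lookup A v)))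

  delA⊆A : ∀ A v i → lookup (delA A v) i ≡ true → lookup A i ≡ true
  delA⊆A A v i p = proj₁ (∧-true⁻ (trans (≡-sym (lookup∘tabulate _ i)) p))

  delA-v : ∀ A v → lookup (delA A v) v ≡ false
  delA-v A v = trans (lookup∘tabulate _ v)
    (trans (cong (λ b → lookup A v ∧ not b) (lookup-⁅⁆-self v)) (∧-zeroʳ _))

  link-disjoint : ∀ A I v → Disjoint A I → Disjoint (linkA A v) (linkI A I v)
  link-disjoint A I v A∩I=∅ i p = trans (lookup∘tabulate _ i)
    (trans (cong₂ (λ o x → o ∨ (lookup A i ∧ x)) (A∩I=∅ i (linkA⊆A A v i p)) (linkA-nonadjacent A v i p))
           (∧-zeroʳ (lookup A i)))

  del-disjoint : ∀ A I v → Disjoint A I → Disjoint (delA A v) (delI I v)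
  del-disjoint A I v A∩I=∅ i p = trans (lookup∘tabulate _ i)
    (cong₂ _∨_ (A∩I=∅ i (delA⊆A A v i p)) (lookup-⁅⁆-other i≢v))
    where
      i≢v : i ≢ v
      i≢v refl = ≡false⇒≢true (delA-v A v) p

  RelInd-vertex : ∀ A I v → lookup A v ≡ true → RelInd A I ⁅ base v ⁆ ≡ true
  RelInd-vertex A I v Av = RelInd⁺ A I ⁅ base v ⁆ (record
    { independent = λ i j p q → subst₂-adj (only-v i p) (only-v j q)
    ; base⊆A      = λ i p → subst (λ k → lookup A k ≡ true) (≡-sym (only-v i p)) Av
    ; leaf⊆A∪I    = λ i p → ⊥-elim (≡false⇒≢true (no-leaf i) p)
    ; notBoth     = λ i _ q → ≡false⇒≢true (no-leaf i) q })
    where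
      only-v : ∀ i → baseOf ⁅ base v ⁆ i ≡ true → i ≡ v
      only-v i p = base-injective (lookup-⁅⁆⁻ p)
      no-leaf : ∀ i → leafOf ⁅ base v ⁆ i ≡ false
      no-leaf i = lookup-⁅⁆-other (λ e → ↑ˡ≢↑ʳ v i (≡-sym e))
      subst₂-adj : ∀ {i j} → i ≡ v → j ≡ v → adj G i j ≡ false
      subst₂-adj refl refl = irrefl G v

  module _ (τ : Subset (N + N)) (v : Fin N) where

    τ+v : Subset (N + N)
    τ+v = τ ∪ ⁅ base v ⁆

    base-τ+v⁺ : ∀ j → baseOf τ j ≡ true → baseOf τ+v j ≡ true
    base-τ+v⁺ j = ∪⁅⁆-old τ (base v) (base j)

    base-τ+v⁻ : ∀ j → baseOf τ+v j ≡ true → (baseOf τ j ≡ true) ⊎ (j ≡ v)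
    base-τ+v⁻ j p = map₂ base-injective (∪⁅⁆⁻ τ (base v) (base j) p)

    leaf-τ+v : ∀ j → leafOf τ+v j ≡ leafOf τ j
    leaf-τ+v j = ∪⁅⁆-other τ (base v) (leaf j) (λ e → ↑ˡ≢↑ʳ v j (≡-sym e))

  link-face⁺ : ∀ A I v τ → baseOf τ v ≡ false → RelFace A I (τ+v τ v) → RelFace (linkA A v) (linkI A I v) τ
  link-face⁺ A I v τ gᵥ∉τ f = record
    { independent = λ i j p q → independent f i j (up i p) (up j q)
    ; base⊆A      = λ i p → trans (lookup∘tabulate _ i)
        (∧-true⁺ (base⊆A f i (up i p))
                 (∧-true⁺ (≡false⇒not≡true (lookup-⁅⁆-other (ne i p)))
                          (≡false⇒not≡true (independent f v i (∪⁅⁆-new τ (base v)) (up i p)))))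
    ; leaf⊆A∪I    = λ i p → subst₂ (λ a o → a ∨ o ≡ true) (≡-sym (lookup∘tabulate _ i)) (≡-sym (lookup∘tabulate _ i))
        (link-leaf⁺ (lookup A i) (lookup I i) (adj G v i) (lookup ⁅ v ⁆ i)
                    (leaf⊆A∪I f i (leaf-up i p)) (lookup-⁅⁆-other (leaf-ne i p)))
    ; notBoth     = λ i p q → notBoth f i (up i p) (leaf-up i q) }
    where
      up = base-τ+v⁺ τ v
      leaf-up : ∀ j → leafOf τ j ≡ true → leafOf (τ+v τ v) j ≡ true
      leaf-up j p = trans (leaf-τ+v τ v j) p
      ne : ∀ j → baseOf τ j ≡ true → j ≢ v
      ne j p refl = ≡false⇒≢true gᵥ∉τ p
      leaf-ne : ∀ j → leafOf τ j ≡ true → j ≢ v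
      leaf-ne j p refl = notBoth f v (∪⁅⁆-new τ (base v)) (leaf-up v p)

  link-face⁻ : ∀ A I v τ → lookup A v ≡ true → Disjoint A I → RelFace (linkA A v) (linkI A I v) τ →
               (baseOf τ v ≡ false) × RelFace A I (τ+v τ v)
  link-face⁻ A I v τ Av A∩I=∅ f = gᵥ∉τ , record
    { independent = λ i j p q → indep (base-τ+v⁻ τ v i p) (base-τ+v⁻ τ v j q)
    ; base⊆A      = λ i p → [ linkA⊆A A v i ∘ base⊆A f i , (λ { refl → Av }) ] (base-τ+v⁻ τ v i p)
    ; leaf⊆A∪I    = λ i p → link-leaf⁻ (lookup A i) (lookup I i) (adj G v i) (lookup ⁅ v ⁆ i)
        (subst₂ (λ a o → a ∨ o ≡ true) (lookup∘tabulate _ i) (lookup∘tabulate _ i) (leaf⊆A∪I f i (down i p)))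
    ; notBoth     = λ i p q → [ (λ b → notBoth f i b (down i q)) , (λ { refl → leaf-v (down v q) }) ]
                                (base-τ+v⁻ τ v i p) }
    where
      down : ∀ j → leafOf (τ+v τ v) j ≡ true → leafOf τ j ≡ true
      down j p = trans (≡-sym (leaf-τ+v τ v j)) p
      gᵥ∉τ : baseOf τ v ≡ false
      gᵥ∉τ = ≢true⇒≡false (λ p → ≡false⇒≢true (linkA-v A v) (base⊆A f v p))
      leaf-v : leafOf τ v ≡ true → Empty
      leaf-v p = ≡false⇒≢true (cong₂ _∨_ (linkA-v A v) (linkI-v A I v Av A∩I=∅)) (leaf⊆A∪I f v p)
      indep : ∀ {i j} → (baseOf τ i ≡ true) ⊎ (i ≡ v) → (baseOf τ j ≡ true) ⊎ (j ≡ v) → adj G i j ≡ false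
      indep {i} {j} (inj₁ p)    (inj₁ q)    = independent f i j p q
      indep {i}     (inj₁ p)    (inj₂ refl) = trans (Graph.sym G i v) (linkA-nonadjacent A v i (base⊆A f i p))
      indep {j = j} (inj₂ refl) (inj₁ q)    = linkA-nonadjacent A v j (base⊆A f j q)
      indep         (inj₂ refl) (inj₂ refl) = irrefl G v

  link-RelInd : ∀ A I v → lookup A v ≡ true → Disjoint A I →
                link (RelInd A I) ⁅ base v ⁆ ≐ RelInd (linkA A v) (linkI A I v)
  link-RelInd A I v Av A∩I=∅ τ rewrite link-condition τ (base v) = bool-ext
    (λ e → let (p , q) = ∧-true⁻ {not (baseOf τ v)} e in
           RelInd⁺ _ _ τ (link-face⁺ A I v τ (not≡true⇒≡false p) (RelInd⁻ A I _ q)))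
    (λ e → let (p , q) = link-face⁻ A I v τ Av A∩I=∅ (RelInd⁻ _ _ τ e) in
           ∧-true⁺ (≡false⇒not≡true p) (RelInd⁺ A I _ q))

  del-face⁺ : ∀ A I v τ → baseOf τ v ≡ false → RelFace A I τ → RelFace (delA A v) (delI I v) τ
  del-face⁺ A I v τ gᵥ∉τ f = record
    { independent = independent f
    ; base⊆A      = λ i p → trans (lookup∘tabulate _ i)
        (∧-true⁺ (base⊆A f i p) (≡false⇒not≡true (lookup-⁅⁆-other (ne i p))))
    ; leaf⊆A∪I    = λ i p → subst₂ (λ a o → a ∨ o ≡ true) (≡-sym (lookup∘tabulate _ i)) (≡-sym (lookup∘tabulate _ i))
        (del-leaf⁺ (lookup A i) (lookup I i) (lookup ⁅ v ⁆ i) (leaf⊆A∪I f i p))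
    ; notBoth     = notBoth f }
    where
      ne : ∀ j → baseOf τ j ≡ true → j ≢ v
      ne j p refl = ≡false⇒≢true gᵥ∉τ p

  del-face⁻ : ∀ A I v τ → lookup A v ≡ true → RelFace (delA A v) (delI I v) τ →
              (baseOf τ v ≡ false) × RelFace A I τ
  del-face⁻ A I v τ Av f = gᵥ∉τ , record
    { independent = independent f
    ; base⊆A      = λ i p → delA⊆A A v i (base⊆A f i p)
    ; leaf⊆A∪I    = λ i p → del-leaf⁻ (lookup A i) (lookup I i) (lookup ⁅ v ⁆ i)
        (λ e → subst (λ k → lookup A k ≡ true) (≡-sym (lookup-⁅⁆⁻ e)) Av)
        (subst₂ (λ a o → a ∨ o ≡ true) (lookup∘tabulate _ i) (lookup∘tabulate _ i) (leaf⊆A∪I f i p))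
    ; notBoth     = notBoth f }
    where
      gᵥ∉τ : baseOf τ v ≡ false
      gᵥ∉τ = ≢true⇒≡false (λ p → ≡false⇒≢true (delA-v A v) (base⊆A f v p))

  del-RelInd : ∀ A I v → lookup A v ≡ true → del (RelInd A I) ⁅ base v ⁆ ≐ RelInd (delA A v) (delI I v)
  del-RelInd A I v Av τ rewrite deletion-condition τ (base v) = bool-ext
    (λ e → let (p , q) = ∧-true⁻ {not (baseOf τ v)} e in
           RelInd⁺ _ _ τ (del-face⁺ A I v τ (not≡true⇒≡false p) (RelInd⁻ A I τ q)))
    (λ e → let (p , q) = del-face⁻ A I v τ Av (RelInd⁻ _ _ τ e) in
           ∧-true⁺ (≡false⇒not≡true p) (RelInd⁺ A I τ q))

  RelInd-VD : ∀ k A I → ∣ A ∣ ≤ k → Disjoint A I → VertexDecomposable (RelInd A I)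
  RelInd-VD k A I |A|≤k A∩I=∅ with emptyOrMember A
  ... | inj₁ A=∅ = simplex (RelInd-pure A I A∩I=∅) (RelInd-simplex A I A=∅)
  RelInd-VD zero A I |A|≤0 A∩I=∅ | inj₂ (v , Av)
    with () ← ℕP.≤-trans (size-strict (delA A v) A v (delA⊆A A v) (delA-v A v) Av) |A|≤0
  RelInd-VD (suc k) A I |A|≤k A∩I=∅ | inj₂ (v , Av) =
    decomp (RelInd-pure A I A∩I=∅) (base v) (RelInd-vertex A I v Av)
      (VD-≐ (≐-sym (link-RelInd A I v Av A∩I=∅))
        (RelInd-VD k (linkA A v) (linkI A I v)
          (smaller (linkA A v) (size-strict (linkA A v) A v (linkA⊆A A v) (linkA-v A v) Av))
          (link-disjoint A I v A∩I=∅)))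
      (VD-≐ (≐-sym (del-RelInd A I v Av))
        (RelInd-VD k (delA A v) (delI I v)
          (smaller (delA A v) (size-strict (delA A v) A v (delA⊆A A v) (delA-v A v) Av))
          (del-disjoint A I v A∩I=∅)))
    where
      smaller : ∀ B → ∣ B ∣ < ∣ A ∣ → ∣ B ∣ ≤ k
      smaller _ lt = ℕP.≤-pred (ℕP.≤-trans lt |A|≤k)

  IndW-VD : VertexDecomposable (Ind W)
  IndW-VD = VD-≐ (≐-sym IndW≐RelInd) (RelInd-VD N ⊤ ⊥ (∣p∣≤n ⊤) (λ i _ → lookup-⊥ i))

ΣL : ∀ {A : Set} → (A → ℤ) → List A → ℤ
ΣL f xs = sumℤ (map f xs)

ΣL-++ : ∀ {A : Set} (f : A → ℤ) xs ys → ΣL f (xs ++ₗ ys) ≡ ΣL f xs +ℤ ΣL f ys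
ΣL-++ f []       ys = ≡-sym (ℤP.+-identityˡ _)
ΣL-++ f (x ∷ xs) ys = trans (cong (f x +ℤ_) (ΣL-++ f xs ys)) (≡-sym (ℤP.+-assoc (f x) _ _))

ΣL-map : ∀ {A B : Set} (f : B → ℤ) (g : A → B) xs → ΣL f (map g xs) ≡ ΣL (f ∘ g) xs
ΣL-map f g []       = refl
ΣL-map f g (x ∷ xs) = cong (f (g x) +ℤ_) (ΣL-map f g xs)

ΣL-cong : ∀ {A : Set} {f g : A → ℤ} → (∀ x → f x ≡ g x) → ∀ xs → ΣL f xs ≡ ΣL g xs
ΣL-cong h []       = refl
ΣL-cong h (x ∷ xs) = cong₂ _+ℤ_ (h x) (ΣL-cong h xs)

ΣL-zero : ∀ {A : Set} {f : A → ℤ} → (∀ x → f x ≡ + 0) → ∀ xs → ΣL f xs ≡ + 0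
ΣL-zero h []       = refl
ΣL-zero h (x ∷ xs) = cong₂ _+ℤ_ (h x) (ΣL-zero h xs)

ΣL-+ : ∀ {A : Set} (f g : A → ℤ) xs → ΣL (λ x → f x +ℤ g x) xs ≡ ΣL f xs +ℤ ΣL g xs
ΣL-+ f g []       = refl
ΣL-+ f g (x ∷ xs) = trans (cong ((f x +ℤ g x) +ℤ_) (ΣL-+ f g xs)) (interchange (f x) (g x) (ΣL f xs) (ΣL g xs))
  where
    interchange : ∀ (a b c d : ℤ) → (a +ℤ b) +ℤ (c +ℤ d) ≡ (a +ℤ c) +ℤ (b +ℤ d)
    interchange = solve-∀

ΣL-*ˡ : ∀ {A : Set} (c : ℤ) (f : A → ℤ) xs → c *ℤ ΣL f xs ≡ ΣL (λ x → c *ℤ f x) xs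
ΣL-*ˡ c f []       = ℤP.*-zeroʳ c
ΣL-*ˡ c f (x ∷ xs) = trans (ℤP.*-distribˡ-+ c (f x) (ΣL f xs)) (cong ((c *ℤ f x) +ℤ_) (ΣL-*ˡ c f xs))

ΣL-swap : ∀ {A B : Set} (F : A → B → ℤ) xs ys →
          ΣL (λ x → ΣL (F x) ys) xs ≡ ΣL (λ y → ΣL (λ x → F x y) xs) ys
ΣL-swap F []       ys = ≡-sym (ΣL-zero (λ _ → refl) ys)
ΣL-swap F (x ∷ xs) ys = trans (cong (ΣL (F x) ys +ℤ_) (ΣL-swap F xs ys))
                              (≡-sym (ΣL-+ (F x) (λ y → ΣL (λ x → F x y) xs) ys))

when : Bool → ℤ → ℤ
when b x = if b then x else + 0

when-∧ : ∀ a b x → when (a ∧ b) x ≡ when a (when b x)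
when-∧ true  b x = refl
when-∧ false b x = refl

ΣL-when : ∀ {A : Set} b (f : A → ℤ) xs → ΣL (λ x → when b (f x)) xs ≡ when b (ΣL f xs)
ΣL-when true  f xs = refl
ΣL-when false f xs = ΣL-zero (λ _ → refl) xs

*-when : ∀ (c : ℤ) b x → c *ℤ when b x ≡ when b (c *ℤ x)
*-when c true  x = refl
*-when c false x = ℤP.*-zeroʳ c

length-filter² : ∀ {A : Set} (p q : A → Bool) xs →
                 + length (filterᵇ q (filterᵇ p xs)) ≡ ΣL (λ x → when (p x ∧ q x) (+ 1)) xs
length-filter² p q [] = refl
length-filter² p q (x ∷ xs) with p x
... | false = trans (length-filter² p q xs) (≡-sym (ℤP.+-identityˡ _))
... | true with q x
...   | true  = cong (+ 1 +ℤ_) (length-filter² p q xs)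
...   | false = trans (length-filter² p q xs) (≡-sym (ℤP.+-identityˡ _))

ΣSub : ∀ n → (Subset n → ℤ) → ℤ
ΣSub n F = ΣL F (allSubsets n)

ΣSub-suc : ∀ n (F : Subset (suc n) → ℤ) → ΣSub (suc n) F ≡ ΣSub n (F ∘ (true ∷_)) +ℤ ΣSub n (F ∘ (false ∷_))
ΣSub-suc n F = trans (ΣL-++ F (map (true ∷_) (allSubsets n)) (map (false ∷_) (allSubsets n)))
                     (cong₂ _+ℤ_ (ΣL-map F (true ∷_) (allSubsets n)) (ΣL-map F (false ∷_) (allSubsets n)))

ΣSub-++ : ∀ a b (F : Subset (a + b) → ℤ) → ΣSub (a + b) F ≡ ΣSub a (λ S → ΣSub b (λ L → F (S ++ L)))
ΣSub-++ zero    b F = ≡-sym (ℤP.+-identityʳ _)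
ΣSub-++ (suc a) b F = begin
  ΣSub (suc a + b) F
    ≡⟨ ΣSub-suc (a + b) F ⟩
  ΣSub (a + b) (F ∘ (true ∷_)) +ℤ ΣSub (a + b) (F ∘ (false ∷_))
    ≡⟨ cong₂ _+ℤ_ (ΣSub-++ a b (F ∘ (true ∷_))) (ΣSub-++ a b (F ∘ (false ∷_))) ⟩
  ΣSub a (λ S → ΣSub b (λ L → F (true ∷ S ++ L))) +ℤ ΣSub a (λ S → ΣSub b (λ L → F (false ∷ S ++ L)))
    ≡⟨ ≡-sym (ΣSub-suc a (λ S → ΣSub b (λ L → F (S ++ L)))) ⟩
  ΣSub (suc a) (λ S → ΣSub b (λ L → F (S ++ L))) ∎

numFaces-as-sum : ∀ {n} (Δ : Complex n) k → + numFaces Δ k ≡ ΣSub n (λ T → when (Δ T ∧ (∣ T ∣ ≡ᵇ k)) (+ 1))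
numFaces-as-sum {n} Δ k = length-filter² Δ (λ S → ∣ S ∣ ≡ᵇ k) (allSubsets n)

<ᵇ-true : ∀ {m n} → m < n → (m <ᵇ n) ≡ true
<ᵇ-true {zero}  (s≤s _) = refl
<ᵇ-true {suc m} (s≤s p) = <ᵇ-true p

<ᵇ-false : ∀ {m n} → n ≤ m → (m <ᵇ n) ≡ false
<ᵇ-false z≤n     = refl
<ᵇ-false (s≤s p) = <ᵇ-false p

≡ᵇ-true : ∀ m → (m ≡ᵇ m) ≡ true
≡ᵇ-true zero    = refl
≡ᵇ-true (suc m) = ≡ᵇ-true m

≡ᵇ-false : ∀ {m n} → m ≢ n → (m ≡ᵇ n) ≡ false
≡ᵇ-false {zero}  {zero}  m≢n = ⊥-elim (m≢n refl)
≡ᵇ-false {zero}  {suc n} _   = refl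
≡ᵇ-false {suc m} {zero}  _   = refl
≡ᵇ-false {suc m} {suc n} m≢n = ≡ᵇ-false (m≢n ∘ cong suc)

sign : ℕ → ℤ
sign k = (- (+ 1)) ^ k

hCoeff : ℕ → ℕ → ℕ → ℤ
hCoeff d j t = sign (j ∸ t) *ℤ + ((d ∸ t) C (j ∸ t))

hWeight : ℕ → ℕ → ℕ → ℤ
hWeight d j t = when (t <ᵇ suc j) (hCoeff d j t)

pick : ∀ (f : ℕ → ℤ) t k → ΣL (λ i → when (t ≡ᵇ i) (f i)) (upTo k) ≡ when (t <ᵇ k) (f t)
pick f t zero    = refl
pick f t (suc k) = begin
  ΣL term (upTo (suc k))                   ≡⟨ cong (ΣL term) (≡-sym (upTo-∷ʳ k)) ⟩
  ΣL term (upTo k ++ₗ (k ∷ []))            ≡⟨ ΣL-++ term (upTo k) (k ∷ []) ⟩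
  ΣL term (upTo k) +ℤ (term k +ℤ + 0)      ≡⟨ cong₂ _+ℤ_ (pick f t k) (ℤP.+-identityʳ (term k)) ⟩
  when (t <ᵇ k) (f t) +ℤ term k            ≡⟨ last (ℕP.<-cmp t k) ⟩
  when (t <ᵇ suc k) (f t)                  ∎
  where
    term = λ i → when (t ≡ᵇ i) (f i)
    last : _ → when (t <ᵇ k) (f t) +ℤ term k ≡ when (t <ᵇ suc k) (f t)
    last (tri< t<k t≢k _) rewrite <ᵇ-true t<k | ≡ᵇ-false t≢k | <ᵇ-true (ℕP.m≤n⇒m≤1+n t<k) = ℤP.+-identityʳ (f t)
    last (tri≈ _ refl _)  rewrite <ᵇ-false (ℕP.≤-refl {t}) | ≡ᵇ-true t | <ᵇ-true (ℕP.n<1+n t) = ℤP.+-identityˡ (f t)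
    last (tri> _ t≢k k<t) rewrite <ᵇ-false (ℕP.<⇒≤ k<t) | ≡ᵇ-false t≢k | <ᵇ-false k<t = refl

hEntry-as-face-sum : ∀ {n} (Δ : Complex n) j →
  hEntry Δ j ≡ ΣSub n (λ T → when (Δ T) (hWeight (dimPlusOne Δ) j ∣ T ∣))
hEntry-as-face-sum {n} Δ j = begin
  hEntry Δ j
    ≡⟨ ΣL-cong term-as-sum (upTo (suc j)) ⟩
  ΣL (λ i → ΣSub n (λ T → when (Δ T ∧ (∣ T ∣ ≡ᵇ i)) (hCoeff d j i))) (upTo (suc j))
    ≡⟨ ΣL-swap (λ i T → when (Δ T ∧ (∣ T ∣ ≡ᵇ i)) (hCoeff d j i)) (upTo (suc j)) (allSubsets n) ⟩
  ΣSub n (λ T → ΣL (λ i → when (Δ T ∧ (∣ T ∣ ≡ᵇ i)) (hCoeff d j i)) (upTo (suc j)))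
    ≡⟨ ΣL-cong weight-of-face (allSubsets n) ⟩
  ΣSub n (λ T → when (Δ T) (hWeight d j ∣ T ∣)) ∎
  where
    d = dimPlusOne Δ
    term-as-sum : ∀ i → sign (j ∸ i) *ℤ (+ (((d ∸ i) C (j ∸ i)) * numFaces Δ i))
                      ≡ ΣSub n (λ T → when (Δ T ∧ (∣ T ∣ ≡ᵇ i)) (hCoeff d j i))
    term-as-sum i = begin
      sign (j ∸ i) *ℤ (+ (((d ∸ i) C (j ∸ i)) * numFaces Δ i))
        ≡⟨ cong (sign (j ∸ i) *ℤ_) (ℤP.pos-* ((d ∸ i) C (j ∸ i)) (numFaces Δ i)) ⟩
      sign (j ∸ i) *ℤ (+ ((d ∸ i) C (j ∸ i)) *ℤ + numFaces Δ i)
        ≡⟨ ≡-sym (ℤP.*-assoc (sign (j ∸ i)) _ _) ⟩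
      hCoeff d j i *ℤ + numFaces Δ i
        ≡⟨ cong (hCoeff d j i *ℤ_) (numFaces-as-sum Δ i) ⟩
      hCoeff d j i *ℤ ΣSub n (λ T → when (Δ T ∧ (∣ T ∣ ≡ᵇ i)) (+ 1))
        ≡⟨ ΣL-*ˡ (hCoeff d j i) _ (allSubsets n) ⟩
      ΣSub n (λ T → hCoeff d j i *ℤ when (Δ T ∧ (∣ T ∣ ≡ᵇ i)) (+ 1))
        ≡⟨ ΣL-cong (λ T → trans (*-when (hCoeff d j i) (Δ T ∧ (∣ T ∣ ≡ᵇ i)) (+ 1))
                                 (cong (when (Δ T ∧ (∣ T ∣ ≡ᵇ i))) (ℤP.*-identityʳ _))) (allSubsets n) ⟩
      ΣSub n (λ T → when (Δ T ∧ (∣ T ∣ ≡ᵇ i)) (hCoeff d j i)) ∎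
    weight-of-face : ∀ T → ΣL (λ i → when (Δ T ∧ (∣ T ∣ ≡ᵇ i)) (hCoeff d j i)) (upTo (suc j))
                         ≡ when (Δ T) (hWeight d j ∣ T ∣)
    weight-of-face T = begin
      ΣL (λ i → when (Δ T ∧ (∣ T ∣ ≡ᵇ i)) (hCoeff d j i)) (upTo (suc j))
        ≡⟨ ΣL-cong (λ i → when-∧ (Δ T) (∣ T ∣ ≡ᵇ i) (hCoeff d j i)) (upTo (suc j)) ⟩
      ΣL (λ i → when (Δ T) (when (∣ T ∣ ≡ᵇ i) (hCoeff d j i))) (upTo (suc j))
        ≡⟨ ΣL-when (Δ T) _ (upTo (suc j)) ⟩
      when (Δ T) (ΣL (λ i → when (∣ T ∣ ≡ᵇ i) (hCoeff d j i)) (upTo (suc j)))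
        ≡⟨ cong (when (Δ T)) (pick (hCoeff d j) ∣ T ∣ (suc j)) ⟩
      when (Δ T) (hWeight d j ∣ T ∣) ∎

-- Pascal's rule for the weights: a free vertex that may or may not be
-- added to a face leaves the total weight of the smaller complex.
hWeight-pascal : ∀ e j t → t ≤ e → hWeight (suc e) j (suc t) +ℤ hWeight (suc e) j t ≡ hWeight e j t
hWeight-pascal e j t t≤e with ℕP.<-cmp t j
... | tri> _ _ j<t   rewrite <ᵇ-false j<t | <ᵇ-false (ℕP.<⇒≤ j<t) = refl
... | tri≈ _ refl _  rewrite <ᵇ-false (ℕP.≤-refl {t}) | <ᵇ-true (ℕP.n<1+n t) | ℕP.n∸n≡0 t = ℤP.+-identityˡ _
hWeight-pascal e (suc j) t t≤e | tri< (s≤s t≤j) _ _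
  rewrite <ᵇ-true (s≤s t≤j) | <ᵇ-true (ℕP.m≤n⇒m≤1+n (s≤s t≤j))
        | ℕP.+-∸-assoc 1 t≤j | ℕP.+-∸-assoc 1 t≤e
        | ≡-sym (nCk+nC[k+1]≡[n+1]C[k+1] (e ∸ t) (j ∸ t))
        | ℤP.pos-+ ((e ∸ t) C (j ∸ t)) ((e ∸ t) C suc (j ∸ t))
  = alternate (sign (j ∸ t)) _ _
  where
    alternate : ∀ (s x y : ℤ) → s *ℤ x +ℤ ((- (+ 1)) *ℤ s) *ℤ (x +ℤ y) ≡ ((- (+ 1)) *ℤ s) *ℤ y
    alternate = solve-∀

hWeight-diagonal : ∀ t j → hWeight t j t ≡ when (t ≡ᵇ j) (+ 1)
hWeight-diagonal t j with ℕP.<-cmp t j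
... | tri> _ t≢j j<t rewrite <ᵇ-false j<t | ≡ᵇ-false t≢j = refl
... | tri≈ _ refl _  rewrite <ᵇ-true (ℕP.n<1+n t) | ≡ᵇ-true t | ℕP.n∸n≡0 t = refl
hWeight-diagonal t (suc j) | tri< (s≤s t≤j) t≢j _
  rewrite <ᵇ-true (ℕP.m≤n⇒m≤1+n (s≤s t≤j)) | ≡ᵇ-false t≢j | ℕP.n∸n≡0 t | ℕP.+-∸-assoc 1 t≤j
  = ℤP.*-zeroʳ (sign (suc (j ∸ t)))

disjointᵇ : ∀ {M} → Subset M → Subset M → Bool
disjointᵇ []      []      = true
disjointᵇ (a ∷ S) (b ∷ L) = not (a ∧ b) ∧ disjointᵇ S L

-- Induction over the coordinates of S, for an arbitrary offset e ≥ t.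
leaf-sum : ∀ {M} (S : Subset M) j e t → t ≤ e →
  ΣSub M (λ L → when (disjointᵇ S L) (hWeight (e + ∣ ∁ S ∣) j (t + ∣ L ∣))) ≡ hWeight e j t
leaf-sum [] j e t _ rewrite ℕP.+-identityʳ e | ℕP.+-identityʳ t = ℤP.+-identityʳ _
leaf-sum {suc M} (true ∷ S) j e t t≤e = begin
  ΣSub (suc M) (λ L → when (disjointᵇ (true ∷ S) L) (hWeight (e + ∣ ∁ S ∣) j (t + ∣ L ∣)))
    ≡⟨ ΣSub-suc M _ ⟩
  ΣSub M (λ _ → + 0) +ℤ ΣSub M (λ L → when (disjointᵇ S L) (hWeight (e + ∣ ∁ S ∣) j (t + ∣ L ∣)))
    ≡⟨ cong₂ _+ℤ_ (ΣL-zero (λ _ → refl) (allSubsets M)) (leaf-sum S j e t t≤e) ⟩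
  + 0 +ℤ hWeight e j t
    ≡⟨ ℤP.+-identityˡ _ ⟩
  hWeight e j t ∎
leaf-sum {suc M} (false ∷ S) j e t t≤e rewrite ℕP.+-suc e (∣ ∁ S ∣) = begin
  ΣSub (suc M) (λ L → when (disjointᵇ (false ∷ S) L) (hWeight (suc e + ∣ ∁ S ∣) j (t + ∣ L ∣)))
    ≡⟨ ΣSub-suc M _ ⟩
  ΣSub M (λ L → when (disjointᵇ S L) (hWeight (suc e + ∣ ∁ S ∣) j (t + suc ∣ L ∣)))
    +ℤ ΣSub M (λ L → when (disjointᵇ S L) (hWeight (suc e + ∣ ∁ S ∣) j (t + ∣ L ∣)))
    ≡⟨ cong₂ _+ℤ_ (trans (ΣL-cong (λ L → cong (λ u → when (disjointᵇ S L) (hWeight (suc e + ∣ ∁ S ∣) j u))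
                                                 (ℕP.+-suc t (∣ L ∣))) (allSubsets M))
                         (leaf-sum S j (suc e) (suc t) (s≤s t≤e)))
                  (leaf-sum S j (suc e) t (ℕP.m≤n⇒m≤1+n t≤e)) ⟩
  hWeight (suc e) j (suc t) +ℤ hWeight (suc e) j t
    ≡⟨ hWeight-pascal e j t t≤e ⟩
  hWeight e j t ∎

leaf-sum-collapses : ∀ {M} (S : Subset M) j →
  ΣSub M (λ L → when (disjointᵇ S L) (hWeight M j (∣ S ∣ + ∣ L ∣))) ≡ when (∣ S ∣ ≡ᵇ j) (+ 1)
leaf-sum-collapses {M} S j = begin
  ΣSub M (λ L → when (disjointᵇ S L) (hWeight M j (∣ S ∣ + ∣ L ∣)))
    ≡⟨ cong (λ d → ΣSub M (λ L → when (disjointᵇ S L) (hWeight d j (∣ S ∣ + ∣ L ∣)))) (≡-sym size+co-size) ⟩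
  ΣSub M (λ L → when (disjointᵇ S L) (hWeight (∣ S ∣ + ∣ ∁ S ∣) j (∣ S ∣ + ∣ L ∣)))
    ≡⟨ leaf-sum S j (∣ S ∣) (∣ S ∣) ℕP.≤-refl ⟩
  hWeight (∣ S ∣) j (∣ S ∣)
    ≡⟨ hWeight-diagonal (∣ S ∣) j ⟩
  when (∣ S ∣ ≡ᵇ j) (+ 1) ∎
  where
    size+co-size : ∣ S ∣ + ∣ ∁ S ∣ ≡ M
    size+co-size = trans (cong (λ k → ∣ S ∣ + k) (∣∁p∣≡n∸∣p∣ S)) (ℕP.m+[n∸m]≡n (∣p∣≤n S))

module _ {n : ℕ} where

  largestSize : List (Subset n) → ℕ
  largestSize = List.foldr (λ S m → ∣ S ∣ ⊔ m) 0

  largestSize-≤ : ∀ xs B → (∀ {T} → T ∈ xs → ∣ T ∣ ≤ B) → largestSize xs ≤ B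
  largestSize-≤ []       B _ = z≤n
  largestSize-≤ (x ∷ xs) B h = ℕP.⊔-lub (h (here refl)) (largestSize-≤ xs B (h ∘ there))

  ≤-largestSize : ∀ {T} xs → T ∈ xs → ∣ T ∣ ≤ largestSize xs
  ≤-largestSize (x ∷ xs) (here refl) = ℕP.m≤m⊔n (∣ x ∣) (largestSize xs)
  ≤-largestSize (x ∷ xs) (there T∈) = ℕP.≤-trans (≤-largestSize xs T∈) (ℕP.m≤n⊔m (∣ x ∣) (largestSize xs))

  largestSize-attained : ∀ x xs → Σ (Subset n) λ U → U ∈ x ∷ xs × ∣ U ∣ ≡ largestSize (x ∷ xs)
  largestSize-attained x [] = x , here refl , ≡-sym (ℕP.⊔-identityʳ ∣ x ∣)
  largestSize-attained x (y ∷ ys) with ℕP.≤-total (largestSize (y ∷ ys)) (∣ x ∣)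
  ... | inj₁ m≤x = x , here refl , ≡-sym (ℕP.m≥n⇒m⊔n≡m m≤x)
  ... | inj₂ x≤m with largestSize-attained y ys
  ...   | U , U∈ , e = U , there U∈ , trans e (≡-sym (ℕP.m≤n⇒m⊔n≡n x≤m))

  allSubsets-complete : ∀ (T : Subset n) → T ∈ allSubsets n
  allSubsets-complete = complete
    where
      complete : ∀ {m} (T : Subset m) → T ∈ allSubsets m
      complete []                = here refl
      complete {suc m} (true ∷ T)  = ∈-++⁺ˡ (∈-map⁺ (true ∷_) (complete T))
      complete {suc m} (false ∷ T) = ∈-++⁺ʳ (map (true ∷_) (allSubsets m)) (∈-map⁺ (false ∷_) (complete T))

  face-listed : ∀ (Δ : Complex n) T → Δ T ≡ true → T ∈ faces Δ
  face-listed Δ T e = ∈-filter⁺ (T? ∘ Δ) (allSubsets-complete T) (Equivalence.from T-≡ e)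

  listed-face : ∀ (Δ : Complex n) {T} → T ∈ faces Δ → Δ T ≡ true
  listed-face Δ T∈ = Equivalence.to T-≡ (proj₂ (∈-filter⁻ (T? ∘ Δ) {xs = allSubsets n} T∈))

  dim-≤ : ∀ (Δ : Complex n) B → (∀ T → Δ T ≡ true → ∣ T ∣ ≤ B) → dimPlusOne Δ ≤ B
  dim-≤ Δ B h = largestSize-≤ (faces Δ) B (λ {T} T∈ → h T (listed-face Δ T∈))

  ≤-dim : ∀ (Δ : Complex n) T → Δ T ≡ true → ∣ T ∣ ≤ dimPlusOne Δ
  ≤-dim Δ T e = ≤-largestSize (faces Δ) (face-listed Δ T e)

  dim-attained : ∀ (Δ : Complex n) T → Δ T ≡ true →
                 Σ (Subset n) λ U → Δ U ≡ true × ∣ U ∣ ≡ dimPlusOne Δ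
  dim-attained Δ T e =
    let (U , U∈ , size) = attained (faces Δ) (face-listed Δ T e) in U , listed-face Δ U∈ , size
    where
      attained : ∀ xs → T ∈ xs → Σ (Subset n) λ U → U ∈ xs × ∣ U ∣ ≡ largestSize xs
      attained (x ∷ xs) _ = largestSize-attained x xs

  numFaces-≢0 : ∀ (Δ : Complex n) T → Δ T ≡ true → numFaces Δ (∣ T ∣) ≢ 0
  numFaces-≢0 Δ T e = nonempty (∈-filter⁺ (T? ∘ (λ S → ∣ S ∣ ≡ᵇ ∣ T ∣)) (face-listed Δ T e) (Equivalence.from T-≡ (≡ᵇ-true ∣ T ∣)))
    where
      nonempty : ∀ {xs : List (Subset n)} → T ∈ xs → length xs ≢ 0
      nonempty {_ ∷ _} _ ()

  numFaces-≡0 : ∀ (Δ : Complex n) k → (∀ T → Δ T ≡ true → ∣ T ∣ ≢ k) → numFaces Δ k ≡ 0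
  numFaces-≡0 Δ k none = ℤP.+-injective (trans (numFaces-as-sum Δ k) (ΣL-zero no-term (allSubsets n)))
    where
      no-term : ∀ T → when (Δ T ∧ (∣ T ∣ ≡ᵇ k)) (+ 1) ≡ + 0
      no-term T with Δ T in e
      ... | false = refl
      ... | true rewrite ≡ᵇ-false (none T e) = refl

dropZeros-nonzero : ∀ k xs → k ≢ 0 → dropWhileᵇ isZeroℤ (+ k ∷ xs) ≡ + k ∷ xs
dropZeros-nonzero zero    xs k≢0 = ⊥-elim (k≢0 refl)
dropZeros-nonzero (suc k) xs _   = refl

dropZeros-downFrom : ∀ (h : ℕ → ℕ) d M → d ≤ M → (∀ j → d < j → j ≤ M → h j ≡ 0) → h d ≢ 0 →
  dropWhileᵇ isZeroℤ (map (+_ ∘ h) (downFrom (suc M))) ≡ map (+_ ∘ h) (downFrom (suc d))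
dropZeros-downFrom h d M d≤M zeros hd≢0 with ℕP.m≤n⇒m<n∨m≡n d≤M
... | inj₂ refl = dropZeros-nonzero (h d) _ hd≢0
dropZeros-downFrom h d (suc M) _ zeros hd≢0 | inj₁ (s≤s d≤M) rewrite zeros (suc M) (s≤s d≤M) ℕP.≤-refl =
  dropZeros-downFrom h d M d≤M (λ j d<j j≤M → zeros j d<j (ℕP.m≤n⇒m≤1+n j≤M)) hd≢0

dropTrailingZeros-upTo : ∀ (h : ℕ → ℕ) d M → d ≤ M → (∀ j → d < j → j ≤ M → h j ≡ 0) → h d ≢ 0 →
  dropTrailingZeros (map (+_ ∘ h) (upTo (suc M))) ≡ map +_ (map h (upTo (suc d)))
dropTrailingZeros-upTo h d M d≤M zeros hd≢0 = begin
  reverse (dropWhileᵇ isZeroℤ (reverse (map f (upTo (suc M)))))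
    ≡⟨ cong (reverse ∘ dropWhileᵇ isZeroℤ) (backwards (suc M)) ⟩
  reverse (dropWhileᵇ isZeroℤ (map f (downFrom (suc M))))
    ≡⟨ cong reverse (dropZeros-downFrom h d M d≤M zeros hd≢0) ⟩
  reverse (map f (downFrom (suc d)))
    ≡⟨ ≡-sym (reverse-map f (downFrom (suc d))) ⟩
  map f (reverse (downFrom (suc d)))
    ≡⟨ cong (map f) (reverse-downFrom (suc d)) ⟩
  map f (upTo (suc d))
    ≡⟨ map-∘ (upTo (suc d)) ⟩
  map +_ (map h (upTo (suc d))) ∎
  where
    f = +_ ∘ h
    backwards : ∀ k → reverse (map f (upTo k)) ≡ map f (downFrom k)
    backwards k = trans (≡-sym (reverse-map f (upTo k))) (cong (map f) (reverse-upTo k))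

disjointᵇ⁻ : ∀ {M} (S L : Subset M) → disjointᵇ S L ≡ true → ∀ i → lookup S i ≡ true → lookup L i ≡ true → Empty
disjointᵇ⁻ (a ∷ S) (b ∷ L) e Fin.zero    = nand⁻ (proj₁ (∧-true⁻ e))
disjointᵇ⁻ (a ∷ S) (b ∷ L) e (Fin.suc i) = disjointᵇ⁻ S L (proj₂ (∧-true⁻ {not (a ∧ b)} e)) i

disjointᵇ⁺ : ∀ {M} (S L : Subset M) → (∀ i → lookup S i ≡ true → lookup L i ≡ true → Empty) → disjointᵇ S L ≡ true
disjointᵇ⁺ []      []      _ = refl
disjointᵇ⁺ (a ∷ S) (b ∷ L) h = ∧-true⁺ (nand⁺ a b (h Fin.zero)) (disjointᵇ⁺ S L (h ∘ Fin.suc))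

disjoint-size : ∀ {M} (S L : Subset M) → disjointᵇ S L ≡ true → ∣ S ∣ + ∣ L ∣ ≤ M
disjoint-size []          []          _ = z≤n
disjoint-size (true ∷ S)  (false ∷ L) e = s≤s (disjoint-size S L e)
disjoint-size (false ∷ S) (true ∷ L)  e rewrite ℕP.+-suc (∣ S ∣) (∣ L ∣) = s≤s (disjoint-size S L e)
disjoint-size (false ∷ S) (false ∷ L) e = ℕP.m≤n⇒m≤1+n (disjoint-size S L e)

module WhiskerHVector {N : ℕ} (G : Graph N) where
  open Whisker G
  open RelFace

  IndW-++ : ∀ S L → Ind W (S ++ L) ≡ Ind G S ∧ disjointᵇ S L
  IndW-++ S L = bool-ext
    (λ e → let f = IndW⇒RelFace (S ++ L) e in ∧-true⁺
      (Ind⁺ G S (λ i j p q → independent f i j (inS i p) (inS j q)))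
      (disjointᵇ⁺ S L (λ i p q → notBoth f i (inS i p) (inL i q))))
    (λ e → let (indep , disj) = ∧-true⁻ {Ind G S} e in RelFace⇒IndW ⊤ ⊥ (S ++ L) (record
      { independent = λ i j p q → Ind⁻ G S indep i j (fromS i p) (fromS j q)
      ; base⊆A      = λ i _ → lookup-⊤ i
      ; leaf⊆A∪I    = λ i _ → ∨-true⁺ˡ _ (lookup-⊤ i)
      ; notBoth     = λ i p q → disjointᵇ⁻ S L disj i (fromS i p) (fromL i q) }))
    where
      inS : ∀ i → lookup S i ≡ true → baseOf (S ++ L) i ≡ true
      inS i = trans (lookup-++ˡ S L i)
      inL : ∀ i → lookup L i ≡ true → leafOf (S ++ L) i ≡ true
      inL i = trans (lookup-++ʳ S L i)
      fromS : ∀ i → baseOf (S ++ L) i ≡ true → lookup S i ≡ true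
      fromS i = trans (≡-sym (lookup-++ˡ S L i))
      fromL : ∀ i → leafOf (S ++ L) i ≡ true → lookup L i ≡ true
      fromL i = trans (≡-sym (lookup-++ʳ S L i))

  IndG-∅ : Ind G ⊥ ≡ true
  IndG-∅ = Ind⁺ G ⊥ (λ i _ p → ⊥-elim (≡false⇒≢true (lookup-⊥ i) p))

  -- Ind W(G) has dimension N - 1: its facets have N vertices, e.g. all leaves.
  dim-IndW : dimPlusOne (Ind W) ≡ N
  dim-IndW = ℕP.≤-antisym (dim-≤ (Ind W) N at-most-N)
    (subst (_≤ dimPlusOne (Ind W)) all-leaves-size
      (≤-dim (Ind W) (leavesOver ⊤) (RelFace⇒IndW ⊤ ⊤ _ (leavesOver-face ⊤ ⊤))))
    where
      at-most-N : ∀ T → Ind W T ≡ true → ∣ T ∣ ≤ N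
      at-most-N T e with Vec.splitAt N T
      ... | S , L , refl = subst (_≤ N) (≡-sym (∣++∣ S L))
        (disjoint-size S L (proj₂ (∧-true⁻ {Ind G S} (trans (≡-sym (IndW-++ S L)) e))))
      all-leaves-size : ∣ leavesOver ⊤ ∣ ≡ N
      all-leaves-size = trans (∣++∣ (⊥ {N}) ⊤) (cong₂ _+_ (∣⊥∣≡0 N) (∣⊤∣≡n N))

  hEntry-IndW : ∀ j → hEntry (Ind W) j ≡ + numFaces (Ind G) j
  hEntry-IndW j = begin
    hEntry (Ind W) j
      ≡⟨ hEntry-as-face-sum (Ind W) j ⟩
    ΣSub (N + N) (λ T → when (Ind W T) (hWeight (dimPlusOne (Ind W)) j ∣ T ∣))
      ≡⟨ cong (λ d → ΣSub (N + N) (λ T → when (Ind W T) (hWeight d j ∣ T ∣))) dim-IndW ⟩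
    ΣSub (N + N) (λ T → when (Ind W T) (hWeight N j ∣ T ∣))
      ≡⟨ ΣSub-++ N N _ ⟩
    ΣSub N (λ S → ΣSub N (λ L → when (Ind W (S ++ L)) (hWeight N j ∣ S ++ L ∣)))
      ≡⟨ ΣL-cong over-leaves (allSubsets N) ⟩
    ΣSub N (λ S → when (Ind G S ∧ (∣ S ∣ ≡ᵇ j)) (+ 1))
      ≡⟨ ≡-sym (numFaces-as-sum (Ind G) j) ⟩
    + numFaces (Ind G) j ∎
    where
      over-leaves : ∀ S → ΣSub N (λ L → when (Ind W (S ++ L)) (hWeight N j ∣ S ++ L ∣))
                        ≡ when (Ind G S ∧ (∣ S ∣ ≡ᵇ j)) (+ 1)
      over-leaves S = begin
        ΣSub N (λ L → when (Ind W (S ++ L)) (hWeight N j ∣ S ++ L ∣))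
          ≡⟨ ΣL-cong (λ L → trans (cong₂ (λ b k → when b (hWeight N j k)) (IndW-++ S L) (∣++∣ S L))
                                  (when-∧ (Ind G S) (disjointᵇ S L) _)) (allSubsets N) ⟩
        ΣSub N (λ L → when (Ind G S) (when (disjointᵇ S L) (hWeight N j (∣ S ∣ + ∣ L ∣))))
          ≡⟨ ΣL-when (Ind G S) _ (allSubsets N) ⟩
        when (Ind G S) (ΣSub N (λ L → when (disjointᵇ S L) (hWeight N j (∣ S ∣ + ∣ L ∣))))
          ≡⟨ cong (when (Ind G S)) (leaf-sum-collapses S j) ⟩
        when (Ind G S) (when (∣ S ∣ ≡ᵇ j) (+ 1))
          ≡⟨ ≡-sym (when-∧ (Ind G S) (∣ S ∣ ≡ᵇ j) (+ 1)) ⟩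
        when (Ind G S ∧ (∣ S ∣ ≡ᵇ j)) (+ 1) ∎

  -- f_{k-1}(Ind G) vanishes exactly beyond dim Ind G + 1 ≤ N.
  IndW-hVector : dropTrailingZeros (hVector (Ind W)) ≡ map +_ (fVector (Ind G))
  IndW-hVector = begin
    dropTrailingZeros (map (hEntry (Ind W)) (upTo (suc (dimPlusOne (Ind W)))))
      ≡⟨ cong (λ d → dropTrailingZeros (map (hEntry (Ind W)) (upTo (suc d)))) dim-IndW ⟩
    dropTrailingZeros (map (hEntry (Ind W)) (upTo (suc N)))
      ≡⟨ cong dropTrailingZeros (map-cong hEntry-IndW (upTo (suc N))) ⟩
    dropTrailingZeros (map (+_ ∘ numFaces (Ind G)) (upTo (suc N)))
      ≡⟨ dropTrailingZeros-upTo (numFaces (Ind G)) dG N dG≤N vanishes top ⟩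
    map +_ (fVector (Ind G)) ∎
    where
      dG = dimPlusOne (Ind G)
      dG≤N : dG ≤ N
      dG≤N = dim-≤ (Ind G) N (λ T _ → ∣p∣≤n T)
      vanishes : ∀ j → dG < j → j ≤ N → numFaces (Ind G) j ≡ 0
      vanishes j dG<j _ = numFaces-≡0 (Ind G) j
        (λ T e refl → ℕP.<-irrefl refl (ℕP.≤-<-trans (≤-dim (Ind G) T e) dG<j))
      top : numFaces (Ind G) dG ≢ 0
      top with dim-attained (Ind G) ⊥ IndG-∅
      ... | U , U∈ , size = subst (λ k → numFaces (Ind G) k ≢ 0) size (numFaces-≢0 (Ind G) U U∈)

corollary3p10 : ∀ {n : ℕ} (G : Graph (suc n)) →
    Σ ℕ λ m → Σ (Graph (suc m)) λ H →
      VertexDecomposable (Ind H) ×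
      (dropTrailingZeros (hVector (Ind H)) ≡ map +_ (fVector (Ind G)))
corollary3p10 G = _ , W , IndW-VD , IndW-hVector
  where
    open Whisker G using (W; IndW-VD)
    open WhiskerHVector G using (IndW-hVector)
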